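{- There exists $m_0$ such that for all $m\geq m_0$ the following holds. Let $G=\mathbb{Z}_2^m\times\mathbb{Z}_4$. Let $t$ be an integer with $3\leq t\leq 0.001f(G)$ and $|I(G)|+2t\equiv 0\pmod 3$, and let $M$ be the multiset consisting of $f(G)-t$ copies of $2$ and $\frac13(|I(G)|+2t)$ copies of $3$. Then $G\setminus\{0\}$ has a zero-sum $M$-partition.
   Context: $G$ is written additively; $I(G)$ is the set of elements of order $2$ and $f(G)=(|G|-|I(G)|-1)/2$. A zero-sum $M$-partition of a set $X$ is a partition of $X$ into sets each summing to $0$ whose multiset of sizes equals $M$. -}

module Defs where

open import Data.Bool using (Bool; true; false; _xor_)
open import Data.Bool.Properties using () renaming (_≟_ to _≟B_)
open import Data.Fin using (Fin; toℕ)
open import Data.Product using (Σ)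
open import Data.Fin.Properties using () renaming (_≟_ to _≟F_)
open import Data.Nat using (ℕ; zero; suc; _+_; _*_; _∸_; _/_)
open import Data.Nat.DivMod using (_mod_)
open import Data.Vec using (Vec; []; _∷_; replicate; zipWith)
import Data.Vec.Properties as VecP
open import Data.Product using (_×_; _,_; proj₁; proj₂)
import Data.Product.Properties as ProdP
open import Data.List using (List; []; _∷_; map; concatMap; allFin; filter; length; foldr; concat)
import Data.List as L
open import Data.List.Relation.Unary.All using (All)
open import Data.List.Relation.Binary.Permutation.Propositional using (_↭_)
open import Relation.Binary.PropositionalEquality using (_≡_)
open import Relation.Binary.Definitions using (DecidableEquality)
open import Relation.Nullary using (¬?)

G : ℕ → Set
G m = Vec Bool m × Fin 4

_+₄_ : Fin 4 → Fin 4 → Fin 4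
a +₄ b = (toℕ a + toℕ b) mod 4

_+G_ : ∀ {m} → G m → G m → G m
(u , a) +G (v , b) = zipWith _xor_ u v , (a +₄ b)

0G : ∀ {m} → G m
0G {m} = replicate m false , Fin.zero

_≟G_ : ∀ {m} → DecidableEquality (G m)
_≟G_ = ProdP.≡-dec (VecP.≡-dec _≟B_) _≟F_

sumG : ∀ {m} → List (G m) → G m
sumG = foldr _+G_ 0G

allVecs : (m : ℕ) → List (Vec Bool m)
allVecs zero = [] ∷ []
allVecs (suc m) = concatMap (λ b → map (b ∷_) (allVecs m)) (false ∷ true ∷ [])

elems : (m : ℕ) → List (G m)
elems m = concatMap (λ v → map (v ,_) (allFin 4)) (allVecs m)

order : ℕ → ℕ
order m = length (elems m)

I : (m : ℕ) → List (G m)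
I m = filter (λ x → ¬? (x ≟G 0G)) (filter (λ x → (x +G x) ≟G 0G) (elems m))

f : ℕ → ℕ
f m = (order m ∸ length (I m) ∸ 1) / 2

nonzero : (m : ℕ) → List (G m)
nonzero m = filter (λ x → ¬? (x ≟G 0G)) (elems m)

-- A zero-sum M-partition of G ∖ {0}, where M is a multiset of sizes given as a list
-- (up to permutation): a list of blocks whose concatenation is a permutation of
-- G ∖ {0} (so the blocks are disjoint sets covering G ∖ {0}), each block sums to 0,
-- and the multiset of block sizes equals M.
ZeroSumPartition : (m : ℕ) → List ℕ → Set
ZeroSumPartition m M =
  Σ (List (List (G m))) λ blocks →
    (concat blocks ↭ nonzero m) × All (λ B → sumG B ≡ 0G) blocks × (map length blocks ↭ M)

-- Write m = a + 2k with a ∈ {1, 2} and identify ℤ₂^m × ℤ₄ with H × GF(4)ᵏ, where H = ℤ₂^a × ℤ₄.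
-- The units 1, ω, ω² of GF(4) split GF(4)ᵏ ∖ {0} into ρ = (4ᵏ − 1)/3 orbits {x, ωx, ω²x}, and for
-- each orbit (h , α) ↦ (h , αx) is a homomorphism H × GF(4) → G. So G ∖ {0} is the disjoint union of
-- (H ∖ {0}) × {0} and one image of H × GF(4)^× per orbit, and zero-sum partitions of these small sets,
-- checked by computation, transport to G. There are two partitions of H × GF(4)^×, differing in how
-- many pairs and triples they use; giving the triple-rich one to s of the ρ orbits, with s read off
-- from t, yields exactly f(G) − t pairs and (|I(G)| + 2t)/3 triples.

module Submission where

open import Defs
open import Data.Nat using (ℕ; _+_; _*_; _∸_; _/_; _≤_; _≥_)
open import Data.Nat.Divisibility using (_∣_)
open import Data.List using (length; replicate; _++_)
open import Data.Product using (∃-syntax)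

open import Data.Bool using (Bool; true; false; T; _xor_)
import Data.Bool.Properties as 𝔹
open import Data.Fin using (Fin; #_)
open import Data.List using (List; []; _∷_; [_]; map; concat; concatMap; foldr; filter; null; allFin; take; drop)
import Data.List.Properties as List
open import Data.List.Relation.Unary.All as All using (All; []; _∷_; all?)
import Data.List.Relation.Unary.All.Properties as Allₚ
open import Data.List.Relation.Binary.Permutation.Propositional
open import Data.List.Relation.Binary.Permutation.Propositional.Properties
import Data.List.Relation.Binary.Permutation.Setoid.Properties as Perm
open import Data.Maybe using (Maybe; just; nothing)
open import Data.Nat using (zero; suc; _^_; _<_; z≤n; s≤s)
import Data.Nat.Properties as ℕ
open import Data.Nat.DivMod using (m*n/n≡m)
open import Data.Nat.Divisibility using (divides; ∣m+n∣m⇒∣n; ∣n⇒∣m*n; m∣m*n)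
open import Data.Nat.Tactic.RingSolver using (solve-∀)
open import Data.Product using (Σ; Σ-syntax; _×_; _,_; proj₁; proj₂)
import Data.Product.Properties as Product
open import Data.Sum using (_⊎_; inj₁; inj₂)
open import Data.Vec as Vec using (Vec; []; _∷_; zipWith) renaming (_++_ to _++ᵥ_)
import Data.Vec.Properties as Vecₚ
open import Function using (_∘_)
open import Level using (0ℓ)
open import Relation.Binary.Definitions using (DecidableEquality)
open import Relation.Binary.PropositionalEquality as ≡ using (_≡_; refl; sym; cong; cong₂; subst; setoid; subst₂; module ≡-Reasoning)
open import Relation.Nullary using (Dec; yes; no; does; _×-dec_)
open import Relation.Nullary.Decidable using (True; toWitness)
open import Relation.Unary using (Pred; Decidable; _⊆_)
open import Relation.Unary.Properties using (∁?)

private variable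
  m n : ℕ

-- Permutations and partitions of lists

module _ {A B : Set} where

  concatMap⁺ : (g : A → List B) {xs ys : List A} → xs ↭ ys → concatMap g xs ↭ concatMap g ys
  concatMap⁺ g refl         = refl
  concatMap⁺ g (prep x p)   = ++⁺ˡ (g x) (concatMap⁺ g p)
  concatMap⁺ g (swap x y p) = ↭-trans (shifts (g x) (g y)) (++⁺ˡ (g y) (++⁺ˡ (g x) (concatMap⁺ g p)))
  concatMap⁺ g (trans p q)  = ↭-trans (concatMap⁺ g p) (concatMap⁺ g q)

  concatMap-cong-↭ : {g h : A → List B} → (∀ x → g x ↭ h x) → ∀ xs → concatMap g xs ↭ concatMap h xs
  concatMap-cong-↭ g↭h []       = refl
  concatMap-cong-↭ g↭h (x ∷ xs) = ++⁺ (g↭h x) (concatMap-cong-↭ g↭h xs)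

  concatMap-++-↭ : (g h : A → List B) (xs : List A) →
                   concatMap (λ x → g x ++ h x) xs ↭ concatMap g xs ++ concatMap h xs
  concatMap-++-↭ g h []       = refl
  concatMap-++-↭ g h (x ∷ xs) = begin
    (g x ++ h x) ++ concatMap (λ x → g x ++ h x) xs   ≡⟨ List.++-assoc (g x) (h x) _ ⟩
    g x ++ h x ++ concatMap (λ x → g x ++ h x) xs     ↭⟨ ++⁺ˡ (g x) (++⁺ˡ (h x) (concatMap-++-↭ g h xs)) ⟩
    g x ++ h x ++ concatMap g xs ++ concatMap h xs    ↭⟨ ++⁺ˡ (g x) (shifts (h x) (concatMap g xs)) ⟩
    g x ++ concatMap g xs ++ h x ++ concatMap h xs    ≡⟨ List.++-assoc (g x) _ _ ⟨
    (g x ++ concatMap g xs) ++ h x ++ concatMap h xs  ∎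
    where open PermutationReasoning

  concatMap-[] : (xs : List A) → concatMap (λ _ → []) xs ≡ ([] {A = B})
  concatMap-[] []       = refl
  concatMap-[] (x ∷ xs) = concatMap-[] xs

  concatMap-map-[_] : (g : A → B) (xs : List A) → concatMap (λ x → [ g x ]) xs ≡ map g xs
  concatMap-map-[ g ] xs = ≡.trans (sym (List.concatMap-map [_] g xs)) (List.concatMap-pure (map g xs))

  concatMap-three : (g₁ g₂ g₃ : A → B) (xs : List A) →
                    concatMap (λ x → g₁ x ∷ g₂ x ∷ g₃ x ∷ []) xs ↭ map g₁ xs ++ map g₂ xs ++ map g₃ xs
  concatMap-three g₁ g₂ g₃ xs = begin
    concatMap (λ x → [ g₁ x ] ++ [ g₂ x ] ++ [ g₃ x ]) xs
      ↭⟨ concatMap-++-↭ (λ x → [ g₁ x ]) (λ x → [ g₂ x ] ++ [ g₃ x ]) xs ⟩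
    concatMap (λ x → [ g₁ x ]) xs ++ concatMap (λ x → [ g₂ x ] ++ [ g₃ x ]) xs
      ↭⟨ ++⁺ˡ _ (concatMap-++-↭ (λ x → [ g₂ x ]) (λ x → [ g₃ x ]) xs) ⟩
    concatMap (λ x → [ g₁ x ]) xs ++ concatMap (λ x → [ g₂ x ]) xs ++ concatMap (λ x → [ g₃ x ]) xs
      ≡⟨ cong₂ _++_ (concatMap-map-[ g₁ ] xs) (cong₂ _++_ (concatMap-map-[ g₂ ] xs) (concatMap-map-[ g₃ ] xs)) ⟩
    map g₁ xs ++ map g₂ xs ++ map g₃ xs ∎
    where open PermutationReasoning

module _ {A B C : Set} where

  concatMap-comm : (k : A → B → List C) (xs : List A) (ys : List B) →
                   concatMap (λ x → concatMap (k x) ys) xs ↭ concatMap (λ y → concatMap (λ x → k x y) xs) ys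
  concatMap-comm k []       ys = ↭-reflexive (sym (concatMap-[] ys))
  concatMap-comm k (x ∷ xs) ys =
    ↭-trans (++⁺ˡ (concatMap (k x) ys) (concatMap-comm k xs ys))
            (↭-sym (concatMap-++-↭ (k x) (λ y → concatMap (λ x → k x y) xs) ys))

  concatMap-concatMap : (h : B → List C) (g : A → List B) (xs : List A) →
                        concatMap h (concatMap g xs) ≡ concatMap (concatMap h ∘ g) xs
  concatMap-concatMap h g []       = refl
  concatMap-concatMap h g (x ∷ xs) =
    ≡.trans (List.concatMap-++ h (g x) (concatMap g xs)) (cong (concatMap h (g x) ++_) (concatMap-concatMap h g xs))

module _ {A : Set} {P : Pred A 0ℓ} (P? : Decidable P) where

  filter-↭-∁ : (xs : List A) → xs ↭ filter P? xs ++ filter (∁? P?) xs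
  filter-↭-∁ xs = ↭-trans (↭ₛ⇒↭ (Perm.partition-↭ (setoid A) P? xs))
                          (↭-reflexive (cong (λ (ys , zs) → ys ++ zs) (List.partition-defn P? xs)))

  length-filter-∁ : (xs : List A) → length (filter P? xs) + length (filter (∁? P?) xs) ≡ length xs
  length-filter-∁ xs = ≡.trans (sym (List.length-++ (filter P? xs))) (↭-length (↭-sym (filter-↭-∁ xs)))

  filter-map : {B : Set} (h : B → A) (xs : List B) → filter P? (map h xs) ≡ map h (filter (P? ∘ h) xs)
  filter-map h []       = refl
  filter-map h (x ∷ xs) with does (P? (h x))
  ... | true  = cong (h x ∷_) (filter-map h xs)
  ... | false = filter-map h xs

  filter-concatMap : {B : Set} (g : B → List A) (xs : List B) →
                     filter P? (concatMap g xs) ≡ concatMap (filter P? ∘ g) xs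
  filter-concatMap g []       = refl
  filter-concatMap g (x ∷ xs) = ≡.trans (List.filter-++ P? (g x) _) (cong (filter P? (g x) ++_) (filter-concatMap g xs))

  filter-filter-⊆ : {Q : Pred A 0ℓ} (Q? : Decidable Q) → P ⊆ Q → (xs : List A) → filter P? (filter Q? xs) ≡ filter P? xs
  filter-filter-⊆ Q? P⊆Q []       = refl
  filter-filter-⊆ Q? P⊆Q (x ∷ xs) with Q? x
  ... | no ¬q = ≡.trans (filter-filter-⊆ Q? P⊆Q xs) (sym (List.filter-reject P? (¬q ∘ P⊆Q)))
  ... | yes _ with does (P? x)
  ...   | true  = cong (x ∷_) (filter-filter-⊆ Q? P⊆Q xs)
  ...   | false = filter-filter-⊆ Q? P⊆Q xs

module _ {A : Set} (_≟_ : DecidableEquality A) where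

  removeFirst : A → List A → Maybe (List A)
  removeFirst x []       = nothing
  removeFirst x (y ∷ ys) with x ≟ y | removeFirst x ys
  ... | yes _ | _         = just ys
  ... | no _  | nothing   = nothing
  ... | no _  | just ys′  = just (y ∷ ys′)

  removeFirst-↭ : ∀ x ys {ys′} → removeFirst x ys ≡ just ys′ → ys ↭ x ∷ ys′
  removeFirst-↭ x (y ∷ ys) eq with x ≟ y | removeFirst x ys in rem
  removeFirst-↭ x (y ∷ ys) refl | yes refl | _     = refl
  removeFirst-↭ x (y ∷ ys) refl | no _ | just ys′  = ↭-trans (prep y (removeFirst-↭ x ys rem)) (swap y x refl)

  isPermutation : List A → List A → Bool
  isPermutation []       ys = null ys
  isPermutation (x ∷ xs) ys with removeFirst x ys
  ... | nothing  = false
  ... | just ys′ = isPermutation xs ys′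

  isPermutation-sound : ∀ xs ys → T (isPermutation xs ys) → xs ↭ ys
  isPermutation-sound []       []       _ = refl
  isPermutation-sound (x ∷ xs) ys p with removeFirst x ys in rem
  ... | just ys′ = ↭-trans (prep x (isPermutation-sound xs ys′ p)) (↭-sym (removeFirst-↭ x ys rem))

module _ {A : Set} (ZeroSum : List A → Set) where

  Partition : List A → List ℕ → Set
  Partition X M = Σ (List (List A)) λ blocks →
    (concat blocks ↭ X) × All ZeroSum blocks × (map length blocks ↭ M)

  partition-↭ : ∀ {X Y M N} → X ↭ Y → M ↭ N → Partition X M → Partition Y N
  partition-↭ X↭Y M↭N (blocks , covers , sums , sizes) = blocks , ↭-trans covers X↭Y , sums , ↭-trans sizes M↭N

  partition-++ : ∀ {X Y M N} → Partition X M → Partition Y N → Partition (X ++ Y) (M ++ N)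
  partition-++ (blocks , covers , sums , sizes) (blocks′ , covers′ , sums′ , sizes′) =
    blocks ++ blocks′ ,
    ↭-trans (↭-reflexive (sym (List.concat-++ blocks blocks′))) (++⁺ covers covers′) ,
    Allₚ.++⁺ sums sums′ ,
    ↭-trans (↭-reflexive (List.map-++ length blocks blocks′)) (++⁺ sizes sizes′)

  partition-[] : Partition [] []
  partition-[] = [] , refl , [] , refl

  partition-concatMap : {Ix : Set} {X : Ix → List A} {M : Ix → List ℕ} →
                        (∀ i → Partition (X i) (M i)) → ∀ is → Partition (concatMap X is) (concatMap M is)
  partition-concatMap P []       = partition-[]
  partition-concatMap P (i ∷ is) = partition-++ (P i) (partition-concatMap P is)

module _ {A B : Set} {Z₁ : List A → Set} {Z₂ : List B → Set} (φ : A → B)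
         (φ-zeroSum : ∀ {bl} → Z₁ bl → Z₂ (map φ bl)) where

  partition-map : ∀ {X M} → Partition Z₁ X M → Partition Z₂ (map φ X) M
  partition-map (blocks , covers , sums , sizes) =
    map (map φ) blocks ,
    ↭-trans (↭-reflexive (List.concat-map blocks)) (map⁺ φ covers) ,
    Allₚ.map⁺ (All.map φ-zeroSum sums) ,
    ↭-trans (↭-reflexive (≡.trans (sym (List.map-∘ blocks)) (List.map-cong (List.length-map φ) blocks))) sizes

module _ {A : Set} {ZeroSum : List A → Set} (_≟_ : DecidableEquality A) (ZeroSum? : Decidable ZeroSum) where

  partition-by-computation : ∀ {X M} blocks →
    {T (isPermutation _≟_ (concat blocks) X)} → {True (all? ZeroSum? blocks)} →
    {T (isPermutation ℕ._≟_ (map length blocks) M)} → Partition ZeroSum X M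
  partition-by-computation {X} {M} blocks {covers} {sums} {sizes} =
    blocks , isPermutation-sound _≟_ _ X covers , toWitness sums , isPermutation-sound ℕ._≟_ _ M sizes

-- ℤ₂-vectors and the GF(4)-action

infixl 6 _⊕_
_⊕_ : Vec Bool n → Vec Bool n → Vec Bool n
_⊕_ = zipWith _xor_

zeros : ∀ n → Vec Bool n
zeros n = Vec.replicate n false

⊕-assoc : (u v w : Vec Bool n) → (u ⊕ v) ⊕ w ≡ u ⊕ (v ⊕ w)
⊕-assoc = Vecₚ.zipWith-assoc 𝔹.xor-assoc

⊕-comm : (u v : Vec Bool n) → u ⊕ v ≡ v ⊕ u
⊕-comm = Vecₚ.zipWith-comm 𝔹.xor-comm

⊕-identityˡ : (v : Vec Bool n) → zeros n ⊕ v ≡ v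
⊕-identityˡ = Vecₚ.zipWith-identityˡ 𝔹.xor-identityˡ

⊕-identityʳ : (v : Vec Bool n) → v ⊕ zeros n ≡ v
⊕-identityʳ = Vecₚ.zipWith-identityʳ 𝔹.xor-identityʳ

⊕-self : (v : Vec Bool n) → v ⊕ v ≡ zeros n
⊕-self []      = refl
⊕-self (b ∷ v) = cong₂ _∷_ (𝔹.xor-same b) (⊕-self v)

⊕-interchange : (u v w x : Vec Bool n) → (u ⊕ v) ⊕ (w ⊕ x) ≡ (u ⊕ w) ⊕ (v ⊕ x)
⊕-interchange u v w x = begin
  (u ⊕ v) ⊕ (w ⊕ x)  ≡⟨ ⊕-assoc u v (w ⊕ x) ⟩
  u ⊕ (v ⊕ (w ⊕ x))  ≡⟨ cong (u ⊕_) (⊕-assoc v w x) ⟨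
  u ⊕ ((v ⊕ w) ⊕ x)  ≡⟨ cong (λ y → u ⊕ (y ⊕ x)) (⊕-comm v w) ⟩
  u ⊕ ((w ⊕ v) ⊕ x)  ≡⟨ cong (u ⊕_) (⊕-assoc w v x) ⟩
  u ⊕ (w ⊕ (v ⊕ x))  ≡⟨ ⊕-assoc u w (v ⊕ x) ⟨
  (u ⊕ w) ⊕ (v ⊕ x)  ∎
  where open ≡-Reasoning

zeros-++ : ∀ m n → zeros (m + n) ≡ zeros m ++ᵥ zeros n
zeros-++ zero    n = refl
zeros-++ (suc m) n = cong (false ∷_) (zeros-++ m n)

⊕-sum : List (Vec Bool n) → Vec Bool n
⊕-sum = foldr _⊕_ (zeros _)

select : Bool → Vec Bool n → Vec Bool n
select false v = zeros _
select true  v = v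

select-xor : ∀ a b (v : Vec Bool n) → select (a xor b) v ≡ select a v ⊕ select b v
select-xor false b v = sym (⊕-identityˡ (select b v))
select-xor true false v = sym (⊕-identityʳ v)
select-xor true true  v = sym (⊕-self v)

-- GF(4) = ℤ₂², the vector b₁ ∷ b₂ ∷ [] standing for b₁ + b₂ω where ω² = ω + 1.
GF4 : Set
GF4 = Vec Bool 2

pattern 𝟘  = false ∷ false ∷ []
pattern 𝟙  = true  ∷ false ∷ []
pattern ω  = false ∷ true  ∷ []
pattern ω² = true  ∷ true  ∷ []

-- Multiplication by ω on each coordinate pair of GF(4)ᵏ: (b₁ + b₂ω)ω = b₂ + (b₁ + b₂)ω.
-- A trailing odd coordinate is left fixed; it never occurs below.
timesω : Vec Bool n → Vec Bool n
timesω []             = []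
timesω (b ∷ [])       = b ∷ []
timesω (b₁ ∷ b₂ ∷ v) = b₂ ∷ (b₁ xor b₂) ∷ timesω v

infixr 7 _·_
_·_ : GF4 → Vec Bool n → Vec Bool n
𝟘  · v = zeros _
𝟙  · v = v
ω  · v = timesω v
ω² · v = v ⊕ timesω v

·-coordinates : ∀ b₁ b₂ (v : Vec Bool n) → (b₁ ∷ b₂ ∷ []) · v ≡ select b₁ v ⊕ select b₂ (timesω v)
·-coordinates false false v = sym (⊕-self (zeros _))
·-coordinates true  false v = sym (⊕-identityʳ v)
·-coordinates false true  v = sym (⊕-identityˡ (timesω v))
·-coordinates true  true  v = refl

·-distribʳ : (α β : GF4) (v : Vec Bool n) → (α ⊕ β) · v ≡ α · v ⊕ β · v
·-distribʳ (a ∷ b ∷ []) (c ∷ d ∷ []) v = begin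
  ((a xor c) ∷ (b xor d) ∷ []) · v
    ≡⟨ ·-coordinates (a xor c) (b xor d) v ⟩
  select (a xor c) v ⊕ select (b xor d) (timesω v)
    ≡⟨ cong₂ _⊕_ (select-xor a c v) (select-xor b d (timesω v)) ⟩
  (select a v ⊕ select c v) ⊕ (select b (timesω v) ⊕ select d (timesω v))
    ≡⟨ ⊕-interchange _ _ _ _ ⟩
  (select a v ⊕ select b (timesω v)) ⊕ (select c v ⊕ select d (timesω v))
    ≡⟨ cong₂ _⊕_ (·-coordinates a b v) (·-coordinates c d v) ⟨
  (a ∷ b ∷ []) · v ⊕ (c ∷ d ∷ []) · v ∎
  where open ≡-Reasoning

·-sum : (Λ : List GF4) (v : Vec Bool n) → ⊕-sum (map (_· v) Λ) ≡ ⊕-sum Λ · v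
·-sum []      v = refl
·-sum (α ∷ Λ) v = ≡.trans (cong (α · v ⊕_) (·-sum Λ v)) (sym (·-distribʳ α (⊕-sum Λ) v))

·-++ : (α : GF4) (p : Vec Bool 2) (v : Vec Bool n) → α · (p ++ᵥ v) ≡ (α · p) ++ᵥ (α · v)
·-++ 𝟘  (_ ∷ _ ∷ []) v = refl
·-++ 𝟙  (_ ∷ _ ∷ []) v = refl
·-++ ω  (_ ∷ _ ∷ []) v = refl
·-++ ω² (_ ∷ _ ∷ []) v = refl

_≟ᵥ_ : DecidableEquality (Vec Bool n)
_≟ᵥ_ = Vecₚ.≡-dec 𝔹._≟_

allVecs-++ : ∀ m n → allVecs (m + n) ≡ concatMap (λ u → map (u ++ᵥ_) (allVecs n)) (allVecs m)
allVecs-++ zero    n = sym (≡.trans (List.++-identityʳ _) (List.map-id (allVecs n)))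
allVecs-++ (suc m) n = begin
  map (false ∷_) (allVecs (m + n)) ++ map (true ∷_) (allVecs (m + n)) ++ []
    ≡⟨ cong (λ vs → map (false ∷_) vs ++ map (true ∷_) vs ++ []) (allVecs-++ m n) ⟩
  map (false ∷_) (concatMap blocks (allVecs m)) ++ map (true ∷_) (concatMap blocks (allVecs m)) ++ []
    ≡⟨ cong₂ (λ xs ys → xs ++ ys ++ []) (prefix false) (prefix true) ⟩
  concatMap blocks (map (false ∷_) (allVecs m)) ++ concatMap blocks (map (true ∷_) (allVecs m)) ++ []
    ≡⟨ concatMap-concatMap blocks (λ b → map (b ∷_) (allVecs m)) (false ∷ true ∷ []) ⟨
  concatMap blocks (allVecs (suc m)) ∎
  where
  open ≡-Reasoning
  blocks : ∀ {m} → Vec Bool m → List (Vec Bool (m + n))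
  blocks u = map (u ++ᵥ_) (allVecs n)
  prefix : ∀ b → map (b ∷_) (concatMap blocks (allVecs m)) ≡ concatMap blocks (map (b ∷_) (allVecs m))
  prefix b = begin
    map (b ∷_) (concatMap blocks (allVecs m))              ≡⟨ List.map-concatMap (b ∷_) blocks (allVecs m) ⟩
    concatMap (map (b ∷_) ∘ blocks) (allVecs m)            ≡⟨ List.concatMap-cong (λ u → List.map-∘ (allVecs n)) (allVecs m) ⟨
    concatMap (blocks ∘ (b ∷_)) (allVecs m)                ≡⟨ List.concatMap-map blocks (b ∷_) (allVecs m) ⟨
    concatMap blocks (map (b ∷_) (allVecs m))              ∎

-- twice k = 2k, by a recursion that makes twice (suc k) reduce to suc (suc (twice k)).
twice : ℕ → ℕ
twice zero    = zero
twice (suc k) = suc (suc (twice k))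

·-[] : (α : GF4) → α · [] ≡ []
·-[] 𝟘  = refl
·-[] 𝟙  = refl
·-[] ω  = refl
·-[] ω² = refl

map-·-++ : (α : GF4) (p : Vec Bool 2) (vs : List (Vec Bool n)) →
           map (α ·_) (map (p ++ᵥ_) vs) ≡ map ((α · p) ++ᵥ_) (map (α ·_) vs)
map-·-++ α p vs = ≡.trans (sym (List.map-∘ vs)) (≡.trans (List.map-cong (·-++ α p) vs) (List.map-∘ vs))

·-permutes : (α : GF4) → map (α ·_) (allVecs 2) ↭ allVecs 2 →
             ∀ k → map (α ·_) (allVecs (twice k)) ↭ allVecs (twice k)
·-permutes α α-permutes zero    = ↭-reflexive (cong [_] (·-[] α))
·-permutes α α-permutes (suc k) = begin
  map (α ·_) (allVecs (2 + twice k))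
    ≡⟨ cong (map (α ·_)) (allVecs-++ 2 (twice k)) ⟩
  map (α ·_) (concatMap (λ p → map (p ++ᵥ_) V) (allVecs 2))
    ≡⟨ List.map-concatMap (α ·_) (λ p → map (p ++ᵥ_) V) (allVecs 2) ⟩
  concatMap (λ p → map (α ·_) (map (p ++ᵥ_) V)) (allVecs 2)
    ≡⟨ List.concatMap-cong (λ p → map-·-++ α p V) (allVecs 2) ⟩
  concatMap (λ p → map ((α · p) ++ᵥ_) (map (α ·_) V)) (allVecs 2)
    ↭⟨ concatMap-cong-↭ (λ p → map⁺ ((α · p) ++ᵥ_) (·-permutes α α-permutes k)) (allVecs 2) ⟩
  concatMap (λ p → map ((α · p) ++ᵥ_) V) (allVecs 2)
    ≡⟨ List.concatMap-map (λ q → map (q ++ᵥ_) V) (α ·_) (allVecs 2) ⟨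
  concatMap (λ q → map (q ++ᵥ_) V) (map (α ·_) (allVecs 2))
    ↭⟨ concatMap⁺ (λ q → map (q ++ᵥ_) V) α-permutes ⟩
  concatMap (λ q → map (q ++ᵥ_) V) (allVecs 2)
    ≡⟨ allVecs-++ 2 (twice k) ⟨
  allVecs (2 + twice k) ∎
  where
  open PermutationReasoning
  V = allVecs (twice k)

units : List GF4
units = 𝟙 ∷ ω ∷ ω² ∷ []

orbit : Vec Bool n → List (Vec Bool n)
orbit v = map (_· v) units

-- The vectors whose first nonzero GF(4)-coordinate is 1: one from each orbit on GF(4)ᵏ ∖ {0}.
representatives : ∀ k → List (Vec Bool (twice k))
representatives zero    = []
representatives (suc k) = map (𝟙 ++ᵥ_) (allVecs (twice k)) ++ map (𝟘 ++ᵥ_) (representatives k)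

allVecs-orbits : ∀ k → zeros (twice k) ∷ concatMap orbit (representatives k) ↭ allVecs (twice k)
allVecs-orbits zero    = refl
allVecs-orbits (suc k) = begin
  zeros _ ∷ concatMap orbit (map (𝟙 ++ᵥ_) V ++ map (𝟘 ++ᵥ_) R)
    ≡⟨ cong (zeros _ ∷_) (List.concatMap-++ orbit (map (𝟙 ++ᵥ_) V) _) ⟩
  zeros _ ∷ concatMap orbit (map (𝟙 ++ᵥ_) V) ++ concatMap orbit (map (𝟘 ++ᵥ_) R)
    ↭⟨ prep (zeros _) (++-comm (concatMap orbit (map (𝟙 ++ᵥ_) V)) _) ⟩
  (zeros _ ∷ concatMap orbit (map (𝟘 ++ᵥ_) R)) ++ concatMap orbit (map (𝟙 ++ᵥ_) V)
    ↭⟨ ++⁺ zero-block unit-blocks ⟩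
  block 𝟘 ++ block 𝟙 ++ block ω ++ block ω²
    ↭⟨ ++⁺ˡ (block 𝟘) (shifts (block 𝟙) (block ω)) ⟩
  block 𝟘 ++ block ω ++ block 𝟙 ++ block ω²
    ≡⟨ cong (λ xs → block 𝟘 ++ block ω ++ block 𝟙 ++ xs) (List.++-identityʳ (block ω²)) ⟨
  concatMap block (allVecs 2)
    ≡⟨ allVecs-++ 2 (twice k) ⟨
  allVecs (twice (suc k)) ∎
  where
  open PermutationReasoning
  V = allVecs (twice k)
  R = representatives k
  block : GF4 → List (Vec Bool (twice (suc k)))
  block p = map (p ++ᵥ_) V
  scaled-block : ∀ α → map (α ·_) (allVecs 2) ↭ allVecs 2 → map ((α · 𝟙) ++ᵥ_) (map (α ·_) V) ↭ block (α · 𝟙)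
  scaled-block α α-permutes = map⁺ ((α · 𝟙) ++ᵥ_) (·-permutes α α-permutes k)
  zero-block : zeros _ ∷ concatMap orbit (map (𝟘 ++ᵥ_) R) ↭ block 𝟘
  zero-block = begin
    zeros _ ∷ concatMap orbit (map (𝟘 ++ᵥ_) R)       ≡⟨ cong (zeros _ ∷_) (List.concatMap-map orbit (𝟘 ++ᵥ_) R) ⟩
    zeros _ ∷ concatMap (map (𝟘 ++ᵥ_) ∘ orbit) R     ≡⟨ cong (zeros _ ∷_) (List.map-concatMap (𝟘 ++ᵥ_) orbit R) ⟨
    map (𝟘 ++ᵥ_) (zeros _ ∷ concatMap orbit R)       ↭⟨ map⁺ (𝟘 ++ᵥ_) (allVecs-orbits k) ⟩
    block 𝟘                                             ∎
  unit-blocks : concatMap orbit (map (𝟙 ++ᵥ_) V) ↭ block 𝟙 ++ block ω ++ block ω²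
  unit-blocks = begin
    concatMap orbit (map (𝟙 ++ᵥ_) V)
      ≡⟨ List.concatMap-map orbit (𝟙 ++ᵥ_) V ⟩
    concatMap (λ v → (𝟙 ++ᵥ v) ∷ (ω ++ᵥ ω · v) ∷ (ω² ++ᵥ ω² · v) ∷ []) V
      ↭⟨ concatMap-three (𝟙 ++ᵥ_) (λ v → ω ++ᵥ ω · v) (λ v → ω² ++ᵥ ω² · v) V ⟩
    block 𝟙 ++ map (λ v → ω ++ᵥ ω · v) V ++ map (λ v → ω² ++ᵥ ω² · v) V
      ≡⟨ cong₂ (λ xs ys → block 𝟙 ++ xs ++ ys) (List.map-∘ V) (List.map-∘ V) ⟩
    block 𝟙 ++ map (ω ++ᵥ_) (map (ω ·_) V) ++ map (ω² ++ᵥ_) (map (ω² ·_) V)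
      ↭⟨ ++⁺ˡ (block 𝟙) (++⁺ (scaled-block ω (isPermutation-sound _≟ᵥ_ _ _ _))
                             (scaled-block ω² (isPermutation-sound _≟ᵥ_ _ _ _))) ⟩
    block 𝟙 ++ block ω ++ block ω² ∎

-- G (m + n) as a union of fibres over ℤ₂ⁿ

extend : Vec Bool n → G m → G (m + n)
extend w (u , c) = u ++ᵥ w , c

extend-0G : extend (zeros n) (0G {m}) ≡ 0G
extend-0G {n} {m} = cong (_, _) (sym (zeros-++ m n))

extend-+G : (v w : Vec Bool n) (g h : G m) → extend (v ⊕ w) (g +G h) ≡ extend v g +G extend w h
extend-+G v w (u , c) (u′ , c′) = cong (_, _) (sym (Vecₚ.zipWith-++ _xor_ u v u′ w))

sumG-extend : {E : Set} (W : E → Vec Bool n) (H : E → G m) (es : List E) →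
              sumG (map (λ e → extend (W e) (H e)) es) ≡ extend (⊕-sum (map W es)) (sumG (map H es))
sumG-extend {n} {m} W H []       = sym (extend-0G {n} {m})
sumG-extend W H (e ∷ es) = ≡.trans (cong (extend (W e) (H e) +G_) (sumG-extend W H es))
                                   (sym (extend-+G (W e) _ (H e) _))

elems-fibres : ∀ m n → elems (m + n) ↭ concatMap (λ w → map (extend w) (elems m)) (allVecs n)
elems-fibres m n = begin
  concatMap quad (allVecs (m + n))
    ≡⟨ cong (concatMap quad) (allVecs-++ m n) ⟩
  concatMap quad (concatMap (λ u → map (u ++ᵥ_) (allVecs n)) (allVecs m))
    ≡⟨ concatMap-concatMap quad (λ u → map (u ++ᵥ_) (allVecs n)) (allVecs m) ⟩
  concatMap (λ u → concatMap quad (map (u ++ᵥ_) (allVecs n))) (allVecs m)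
    ≡⟨ List.concatMap-cong (λ u → List.concatMap-map quad (u ++ᵥ_) (allVecs n)) (allVecs m) ⟩
  concatMap (λ u → concatMap (λ w → quad (u ++ᵥ w)) (allVecs n)) (allVecs m)
    ↭⟨ concatMap-comm (λ u w → quad (u ++ᵥ w)) (allVecs m) (allVecs n) ⟩
  concatMap (λ w → concatMap (λ u → quad (u ++ᵥ w)) (allVecs m)) (allVecs n)
    ≡⟨ List.concatMap-cong fibre (allVecs n) ⟨
  concatMap (λ w → map (extend w) (elems m)) (allVecs n) ∎
  where
  open PermutationReasoning
  quad : ∀ {k} → Vec Bool k → List (G k)
  quad v = map (v ,_) (allFin 4)
  fibre : ∀ w → map (extend w) (elems m) ≡ concatMap (λ u → quad (u ++ᵥ w)) (allVecs m)
  fibre w = ≡.trans (List.map-concatMap (extend w) quad (allVecs m))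
                    (List.concatMap-cong (λ u → sym (List.map-∘ {g = extend w} {f = u ,_} (allFin 4))) (allVecs m))

isZero : (x : G m) → Dec (x ≡ 0G)
isZero x = x ≟G 0G

filter-zeros : ∀ n → filter (_≟ᵥ zeros n) (allVecs n) ≡ [ zeros n ]
filter-zeros zero    = refl
filter-zeros (suc n) = begin
  filter (_≟ᵥ zeros (suc n)) (map (false ∷_) V ++ map (true ∷_) V ++ [])
    ≡⟨ List.filter-++ (_≟ᵥ zeros (suc n)) (map (false ∷_) V) _ ⟩
  filter (_≟ᵥ zeros (suc n)) (map (false ∷_) V) ++ filter (_≟ᵥ zeros (suc n)) (map (true ∷_) V ++ [])
    ≡⟨ cong₂ _++_ (filter-map (_≟ᵥ zeros (suc n)) (false ∷_) V)
                  (List.filter-none (_≟ᵥ zeros (suc n)) (Allₚ.++⁺ (Allₚ.map⁺ (All.universal (λ _ ()) V)) [])) ⟩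
  map (false ∷_) (filter ((_≟ᵥ zeros (suc n)) ∘ (false ∷_)) V) ++ []
    ≡⟨ cong (λ vs → map (false ∷_) vs ++ []) (List.filter-≐ _ (_≟ᵥ zeros n) (cong Vec.tail , cong (false ∷_)) V) ⟩
  map (false ∷_) (filter (_≟ᵥ zeros n) V) ++ []
    ≡⟨ cong (λ vs → map (false ∷_) vs ++ []) (filter-zeros n) ⟩
  [ zeros (suc n) ] ∎
  where
  open ≡-Reasoning
  V = allVecs n

filter-isZero : ∀ m → filter isZero (elems m) ≡ [ 0G ]
filter-isZero m = begin
  filter isZero (concatMap quad (allVecs m))
    ≡⟨ filter-concatMap isZero quad (allVecs m) ⟩
  concatMap (filter isZero ∘ quad) (allVecs m)
    ≡⟨ List.concatMap-cong fibre (allVecs m) ⟩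
  concatMap (λ v → filter isZero [ (v , Fin.zero) ]) (allVecs m)
    ≡⟨ filter-concatMap isZero (λ v → [ (v , Fin.zero) ]) (allVecs m) ⟨
  filter isZero (concatMap (λ v → [ (v , Fin.zero) ]) (allVecs m))
    ≡⟨ cong (filter isZero) (concatMap-map-[ _, Fin.zero ] (allVecs m)) ⟩
  filter isZero (map (_, Fin.zero) (allVecs m))
    ≡⟨ filter-map isZero (_, Fin.zero) (allVecs m) ⟩
  map (_, Fin.zero) (filter (isZero ∘ (_, Fin.zero)) (allVecs m))
    ≡⟨ cong (map (_, Fin.zero)) (List.filter-≐ _ (_≟ᵥ zeros m) (cong proj₁ , cong (_, Fin.zero)) (allVecs m)) ⟩
  map (_, Fin.zero) (filter (_≟ᵥ zeros m) (allVecs m))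
    ≡⟨ cong (map (_, Fin.zero)) (filter-zeros m) ⟩
  [ 0G ] ∎
  where
  open ≡-Reasoning
  quad : Vec Bool m → List (G m)
  quad v = map (v ,_) (allFin 4)
  fibre : ∀ v → filter isZero (quad v) ≡ filter isZero [ (v , Fin.zero) ]
  fibre v = begin
    filter isZero ([ (v , Fin.zero) ] ++ rest)  ≡⟨ List.filter-++ isZero [ (v , Fin.zero) ] rest ⟩
    filter isZero [ (v , Fin.zero) ] ++ filter isZero rest
                                                ≡⟨ cong (filter isZero [ (v , Fin.zero) ] ++_)
                                                        (List.filter-none isZero {rest} ((λ ()) ∷ (λ ()) ∷ (λ ()) ∷ [])) ⟩
    filter isZero [ (v , Fin.zero) ] ++ []      ≡⟨ List.++-identityʳ _ ⟩
    filter isZero [ (v , Fin.zero) ]            ∎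
    where rest = (v , # 1) ∷ (v , # 2) ∷ (v , # 3) ∷ []

elems↭0∷nonzero : ∀ m → elems m ↭ 0G ∷ nonzero m
elems↭0∷nonzero m = ↭-trans (filter-↭-∁ isZero (elems m)) (↭-reflexive (cong (_++ nonzero m) (filter-isZero m)))

Cell : ℕ → Set
Cell m = G m × GF4

embed : Vec Bool n → Cell m → G (m + n)
embed x (g , α) = extend (α · x) g

CellZeroSum : List (Cell m) → Set
CellZeroSum B = sumG (map proj₁ B) ≡ 0G × ⊕-sum (map proj₂ B) ≡ 𝟘

embed-zeroSum : (x : Vec Bool n) {B : List (Cell m)} → CellZeroSum B → sumG (map (embed x) B) ≡ 0G
embed-zeroSum {n} {m} x {B} (g-sum , α-sum) = begin
  sumG (map (embed x) B)                                   ≡⟨ sumG-extend (λ c → proj₂ c · x) proj₁ B ⟩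
  extend (⊕-sum (map (λ c → proj₂ c · x) B)) (sumG (map proj₁ B))
    ≡⟨ cong₂ extend (≡.trans (cong ⊕-sum (List.map-∘ B)) (·-sum (map proj₂ B) x)) g-sum ⟩
  extend (⊕-sum (map proj₂ B) · x) 0G                      ≡⟨ cong (λ α → extend (α · x) 0G) α-sum ⟩
  extend (zeros n) 0G                                      ≡⟨ extend-0G {n} {m} ⟩
  0G                                                       ∎
  where open ≡-Reasoning

cells : ∀ m → List (Cell m)
cells m = concatMap (λ α → map (_, α) (elems m)) units

embed-cells : ∀ m (x : Vec Bool n) → map (embed x) (cells m) ≡ concatMap (λ w → map (extend w) (elems m)) (orbit x)
embed-cells m x = begin
  map (embed x) (cells m)
    ≡⟨ List.map-concatMap (embed x) (λ α → map (_, α) (elems m)) units ⟩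
  concatMap (λ α → map (embed x) (map (_, α) (elems m))) units
    ≡⟨ List.concatMap-cong (λ α → List.map-∘ {g = embed x} {f = _, α} (elems m)) units ⟨
  concatMap (λ α → map (extend (α · x)) (elems m)) units
    ≡⟨ List.concatMap-map (λ w → map (extend w) (elems m)) (_· x) units ⟨
  concatMap (λ w → map (extend w) (elems m)) (orbit x) ∎
  where open ≡-Reasoning

nonzero-orbits : ∀ m k → map (embed (zeros (twice k))) (map (_, 𝟘) (nonzero m)) ++
                         concatMap (λ x → map (embed x) (cells m)) (representatives k)
                         ↭ nonzero (m + twice k)
nonzero-orbits m k = drop-∷ (begin
  0G ∷ map (embed z) (map (_, 𝟘) (nonzero m)) ++ concatMap (λ x → map (embed x) (cells m)) R
    ≡⟨ cong₂ (λ g gs → g ∷ gs ++ concatMap (λ x → map (embed x) (cells m)) R)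
             (sym (extend-0G {twice k} {m})) (sym (List.map-∘ {g = embed z} {f = _, 𝟘} (nonzero m))) ⟩
  map (extend z) (0G ∷ nonzero m) ++ concatMap (λ x → map (embed x) (cells m)) R
    ↭⟨ ++⁺ (map⁺ (extend z) (↭-sym (elems↭0∷nonzero m))) (↭-reflexive (List.concatMap-cong (embed-cells m) R)) ⟩
  fibre z ++ concatMap (concatMap fibre ∘ orbit) R
    ≡⟨ cong (fibre z ++_) (concatMap-concatMap fibre orbit R) ⟨
  concatMap fibre (z ∷ concatMap orbit R)
    ↭⟨ concatMap⁺ fibre (allVecs-orbits k) ⟩
  concatMap fibre (allVecs (twice k))
    ↭⟨ elems-fibres m (twice k) ⟨
  elems (m + twice k)
    ↭⟨ elems↭0∷nonzero (m + twice k) ⟩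
  0G ∷ nonzero (m + twice k) ∎)
  where
  open PermutationReasoning
  z = zeros (twice k)
  R = representatives k
  fibre : Vec Bool (twice k) → List (G (m + twice k))
  fibre w = map (extend w) (elems m)

length-concatMap-const : {A B : Set} (g : A → List B) {c : ℕ} → (∀ x → length (g x) ≡ c) →
                         (xs : List A) → length (concatMap g xs) ≡ length xs * c
length-concatMap-const g g-length []       = refl
length-concatMap-const g g-length (x ∷ xs) =
  ≡.trans (List.length-++ (g x)) (cong₂ _+_ (g-length x) (length-concatMap-const g g-length xs))

length-allVecs : ∀ n → length (allVecs n) ≡ 2 ^ n
length-allVecs zero    = refl
length-allVecs (suc n) = begin
  length (map (false ∷_) (allVecs n) ++ map (true ∷_) (allVecs n) ++ [])
    ≡⟨ List.length-++ (map (false ∷_) (allVecs n)) ⟩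
  length (map (false ∷_) (allVecs n)) + length (map (true ∷_) (allVecs n) ++ [])
    ≡⟨ cong₂ _+_ (List.length-map (false ∷_) (allVecs n))
                 (≡.trans (cong length (List.++-identityʳ (map (true ∷_) (allVecs n)))) (List.length-map (true ∷_) (allVecs n))) ⟩
  length (allVecs n) + length (allVecs n)
    ≡⟨ cong (λ l → l + l) (length-allVecs n) ⟩
  2 ^ n + 2 ^ n
    ≡⟨ cong (2 ^ n +_) (ℕ.+-identityʳ (2 ^ n)) ⟨
  2 ^ suc n ∎
  where open ≡-Reasoning

length-elems : ∀ m → order m ≡ 2 ^ m * 4
length-elems m = ≡.trans (length-concatMap-const (λ v → map (v ,_) (allFin 4)) (λ _ → refl) (allVecs m))
                         (cong (_* 4) (length-allVecs m))

length-representatives : ∀ k → suc (length (representatives k) * 3) ≡ 2 ^ twice k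
length-representatives k = begin
  suc (length (representatives k) * 3)          ≡⟨ cong suc (length-concatMap-const orbit (λ _ → refl) (representatives k)) ⟨
  length (zeros _ ∷ concatMap orbit (representatives k)) ≡⟨ ↭-length (allVecs-orbits k) ⟩
  length (allVecs (twice k))                    ≡⟨ length-allVecs (twice k) ⟩
  2 ^ twice k                                   ∎
  where open ≡-Reasoning

hasOrder≤2 : (x : G m) → Dec (x +G x ≡ 0G)
hasOrder≤2 x = (x +G x) ≟G 0G

-- In the fibre of v only (v , 0) and (v , 2) have order at most 2.
length-filter-hasOrder≤2 : ∀ m → length (filter hasOrder≤2 (elems m)) ≡ 2 ^ m * 2
length-filter-hasOrder≤2 m = begin
  length (filter hasOrder≤2 (concatMap quad (allVecs m)))       ≡⟨ cong length (filter-concatMap hasOrder≤2 quad (allVecs m)) ⟩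
  length (concatMap (filter hasOrder≤2 ∘ quad) (allVecs m))     ≡⟨ length-concatMap-const _ fibre (allVecs m) ⟩
  length (allVecs m) * 2                                       ≡⟨ cong (_* 2) (length-allVecs m) ⟩
  2 ^ m * 2                                                    ∎
  where
  open ≡-Reasoning
  quad : Vec Bool m → List (G m)
  quad v = map (v ,_) (allFin 4)
  fibre : ∀ v → length (filter hasOrder≤2 (quad v)) ≡ 2
  fibre v
    rewrite List.filter-accept hasOrder≤2 {v , # 0} {(v , # 1) ∷ (v , # 2) ∷ (v , # 3) ∷ []} (cong (_, # 0) (⊕-self v))
          | List.filter-reject hasOrder≤2 {v , # 1} {(v , # 2) ∷ (v , # 3) ∷ []} (λ ())
          | List.filter-accept hasOrder≤2 {v , # 2} {(v , # 3) ∷ []} (cong (_, # 0) (⊕-self v))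
          | List.filter-reject hasOrder≤2 {v , # 3} {[]} (λ ())
          = refl

suc-length-I : ∀ m → suc (length (I m)) ≡ 2 ^ m * 2
suc-length-I m = begin
  length [ 0G {m} ] + length (I m)
    ≡⟨ cong (λ zs → length zs + length (I m)) zero-only ⟨
  length (filter isZero (filter hasOrder≤2 (elems m))) + length (I m)
    ≡⟨ length-filter-∁ isZero (filter hasOrder≤2 (elems m)) ⟩
  length (filter hasOrder≤2 (elems m))
    ≡⟨ length-filter-hasOrder≤2 m ⟩
  2 ^ m * 2 ∎
  where
  open ≡-Reasoning
  zero-only : filter isZero (filter hasOrder≤2 (elems m)) ≡ [ 0G ]
  zero-only = ≡.trans (filter-filter-⊆ isZero hasOrder≤2 (λ { refl → cong (_, # 0) (⊕-self (zeros m)) }) (elems m))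
                      (filter-isZero m)

f≡2^ : ∀ m → f m ≡ 2 ^ m
f≡2^ m = begin
  (order m ∸ length (I m) ∸ 1) / 2        ≡⟨ cong (_/ 2) (ℕ.∸-+-assoc (order m) (length (I m)) 1) ⟩
  (order m ∸ (length (I m) + 1)) / 2      ≡⟨ cong₂ (λ a b → (a ∸ b) / 2) (length-elems m)
                                                     (≡.trans (ℕ.+-comm _ 1) (suc-length-I m)) ⟩
  (2 ^ m * 4 ∸ 2 ^ m * 2) / 2             ≡⟨ cong (λ a → (a ∸ 2 ^ m * 2) / 2) (split (2 ^ m)) ⟩
  (2 ^ m * 2 + 2 ^ m * 2 ∸ 2 ^ m * 2) / 2 ≡⟨ cong (_/ 2) (ℕ.m+n∸m≡n (2 ^ m * 2) (2 ^ m * 2)) ⟩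
  2 ^ m * 2 / 2                           ≡⟨ m*n/n≡m (2 ^ m) 2 ⟩
  2 ^ m                                   ∎
  where
  open ≡-Reasoning
  split : ∀ x → x * 4 ≡ x * 2 + x * 2
  split = solve-∀

twosThrees : ℕ → ℕ → List ℕ
twosThrees p q = replicate p 2 ++ replicate q 3

replicate-+ : ∀ {A : Set} p q (x : A) → replicate (p + q) x ≡ replicate p x ++ replicate q x
replicate-+ zero    q x = refl
replicate-+ (suc p) q x = cong (x ∷_) (replicate-+ p q x)

twosThrees-++ : ∀ p q p′ q′ → twosThrees p q ++ twosThrees p′ q′ ↭ twosThrees (p + p′) (q + q′)
twosThrees-++ p q p′ q′ = begin
  (replicate p 2 ++ replicate q 3) ++ replicate p′ 2 ++ replicate q′ 3
    ≡⟨ List.++-assoc (replicate p 2) _ _ ⟩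
  replicate p 2 ++ replicate q 3 ++ replicate p′ 2 ++ replicate q′ 3
    ↭⟨ ++⁺ˡ (replicate p 2) (shifts (replicate q 3) (replicate p′ 2)) ⟩
  replicate p 2 ++ replicate p′ 2 ++ replicate q 3 ++ replicate q′ 3
    ≡⟨ List.++-assoc (replicate p 2) _ _ ⟨
  (replicate p 2 ++ replicate p′ 2) ++ replicate q 3 ++ replicate q′ 3
    ≡⟨ cong₂ _++_ (replicate-+ p p′ 2) (replicate-+ q q′ 3) ⟨
  twosThrees (p + p′) (q + q′) ∎
  where open PermutationReasoning

concatMap-twosThrees : ∀ {A : Set} p q (xs : List A) →
                       concatMap (λ _ → twosThrees p q) xs ↭ twosThrees (length xs * p) (length xs * q)
concatMap-twosThrees p q []       = refl
concatMap-twosThrees p q (x ∷ xs) =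
  ↭-trans (++⁺ˡ (twosThrees p q) (concatMap-twosThrees p q xs)) (twosThrees-++ p q _ _)

GZeroSum : ∀ {m} → List (G m) → Set
GZeroSum B = sumG B ≡ 0G

-- Using triplesOrbit on s of the ρ orbits and pairsOrbit on the others gives P pairs and Q triples.
record Mix (ρ P Q p₀ q₀ p₁ q₁ p₂ q₂ : ℕ) : Set where
  field
    s       : ℕ
    s≤ρ     : s ≤ ρ
    pairs   : P ≡ p₀ + (s * p₁ + (ρ ∸ s) * p₂)
    triples : Q ≡ q₀ + (s * q₁ + (ρ ∸ s) * q₂)

record Template (m p₀ q₀ p₁ q₁ p₂ q₂ : ℕ) : Set where
  field
    centre : Partition CellZeroSum (map (_, 𝟘) (nonzero m)) (twosThrees p₀ q₀)
    triplesOrbit : Partition CellZeroSum (cells m) (twosThrees p₁ q₁)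
    pairsOrbit : Partition CellZeroSum (cells m) (twosThrees p₂ q₂)

  zeroSumPartition-split : ∀ k (xs ys : List (Vec Bool (twice k))) → xs ++ ys ≡ representatives k →
    ZeroSumPartition (m + twice k)
      (twosThrees (p₀ + (length xs * p₁ + length ys * p₂)) (q₀ + (length xs * q₁ + length ys * q₂)))
  zeroSumPartition-split k xs ys split =
    partition-↭ GZeroSum covers sizes
      (partition-++ GZeroSum (transport z centre)
        (partition-++ GZeroSum (partition-concatMap GZeroSum (λ x → transport x triplesOrbit) xs)
                               (partition-concatMap GZeroSum (λ x → transport x pairsOrbit) ys)))
    where
    z = zeros (twice k)
    transport : ∀ x {X M} → Partition CellZeroSum X M → Partition GZeroSum (map (embed x) X) M
    transport x = partition-map (embed x) (λ {B} → embed-zeroSum x {B})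
    onOrbit : Vec Bool (twice k) → List (G (m + twice k))
    onOrbit x = map (embed x) (cells m)
    covers : map (embed z) (map (_, 𝟘) (nonzero m)) ++ concatMap onOrbit xs ++ concatMap onOrbit ys ↭ nonzero (m + twice k)
    covers = ↭-trans (↭-reflexive (cong (map (embed z) (map (_, 𝟘) (nonzero m)) ++_)
                                       (≡.trans (sym (List.concatMap-++ onOrbit xs ys)) (cong (concatMap onOrbit) split))))
                     (nonzero-orbits m k)
    sizes : twosThrees p₀ q₀ ++ concatMap (λ _ → twosThrees p₁ q₁) xs ++ concatMap (λ _ → twosThrees p₂ q₂) ys
            ↭ twosThrees (p₀ + (length xs * p₁ + length ys * p₂)) (q₀ + (length xs * q₁ + length ys * q₂))
    sizes = ↭-trans (++⁺ˡ (twosThrees p₀ q₀) (↭-trans (++⁺ (concatMap-twosThrees p₁ q₁ xs) (concatMap-twosThrees p₂ q₂ ys))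
                                                      (twosThrees-++ (length xs * p₁) (length xs * q₁) (length ys * p₂) (length ys * q₂))))
                    (twosThrees-++ p₀ q₀ (length xs * p₁ + length ys * p₂) (length xs * q₁ + length ys * q₂))

  zeroSumPartition : ∀ k {P Q} → Mix (length (representatives k)) P Q p₀ q₀ p₁ q₁ p₂ q₂ →
                     ZeroSumPartition (m + twice k) (twosThrees P Q)
  zeroSumPartition k mix =
    subst (ZeroSumPartition (m + twice k)) (sym (cong₂ twosThrees pairs′ triples′))
          (zeroSumPartition-split k (take s R) (drop s R) (List.take++drop≡id s R))
    where
    open Mix mix
    R = representatives k
    lengths : ∀ c₀ c₁ c₂ → c₀ + (s * c₁ + (length R ∸ s) * c₂) ≡ c₀ + (length (take s R) * c₁ + length (drop s R) * c₂)
    lengths c₀ c₁ c₂ = cong₂ (λ a b → c₀ + (a * c₁ + b * c₂))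
                             (sym (≡.trans (List.length-take s R) (ℕ.m≤n⇒m⊓n≡m s≤ρ))) (sym (List.length-drop s R))
    pairs′ = ≡.trans pairs (lengths p₀ p₁ p₂)
    triples′ = ≡.trans triples (lengths q₀ q₁ q₂)

_≟Cell_ : DecidableEquality (Cell m)
_≟Cell_ = Product.≡-dec _≟G_ _≟ᵥ_

cellZeroSum? : Decidable (CellZeroSum {m})
cellZeroSum? B = (sumG (map proj₁ B) ≟G 0G) ×-dec (⊕-sum (map proj₂ B) ≟ᵥ 𝟘)

pattern ₀ = false
pattern ₁ = true

cell : Vec Bool m → (c : ℕ) {c<4 : True (c ℕ.<? 4)} → GF4 → Cell m
cell u c {c<4} α = (u , #_ c {m<n = c<4}) , α

negationPairs : List (Vec Bool m) → List GF4 → List (List (Cell m))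
negationPairs us αs = concatMap (λ α → map (λ u → cell u 1 α ∷ cell u 3 α ∷ []) us) αs

-- Two ways to split the nine cells ((0 , c) , α), c ∈ {0, 1, 3}: three pairs and a triple, or three triples.
zeroColumn-pairs zeroColumn-triples : List (List (Cell m))
zeroColumn-pairs {m} =
  negationPairs (zeros m ∷ []) units ++ (cell (zeros m) 0 𝟙 ∷ cell (zeros m) 0 ω ∷ cell (zeros m) 0 ω² ∷ []) ∷ []
zeroColumn-triples {m} =
  (cell (zeros m) 1 ω  ∷ cell (zeros m) 3 ω² ∷ cell (zeros m) 0 𝟙  ∷ []) ∷
  (cell (zeros m) 1 ω² ∷ cell (zeros m) 3 𝟙  ∷ cell (zeros m) 0 ω  ∷ []) ∷
  (cell (zeros m) 1 𝟙  ∷ cell (zeros m) 3 ω  ∷ cell (zeros m) 0 ω² ∷ []) ∷ []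

template₁ : Template 1 2 1 3 6 6 4
template₁ = record
  { centre = partition-by-computation _≟Cell_ cellZeroSum? (negationPairs (allVecs 1) (𝟘 ∷ []) ++
      (cell (₁ ∷ []) 0 𝟘 ∷ cell (₀ ∷ []) 2 𝟘 ∷ cell (₁ ∷ []) 2 𝟘 ∷ []) ∷ [])
  ; triplesOrbit = partition-by-computation _≟Cell_ cellZeroSum? (shared ++ zeroColumn-triples)
  ; pairsOrbit   = partition-by-computation _≟Cell_ cellZeroSum? (shared ++ zeroColumn-pairs)
  }
  where
  shared : List (List (Cell 1))
  shared = negationPairs ((₁ ∷ []) ∷ []) units ++
    (cell (₁ ∷ []) 0 𝟙 ∷ cell (₁ ∷ []) 2 ω ∷ cell (₀ ∷ []) 2 ω² ∷ []) ∷
    (cell (₀ ∷ []) 2 𝟙 ∷ cell (₁ ∷ []) 0 ω ∷ cell (₁ ∷ []) 2 ω² ∷ []) ∷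
    (cell (₁ ∷ []) 2 𝟙 ∷ cell (₀ ∷ []) 2 ω ∷ cell (₁ ∷ []) 0 ω² ∷ []) ∷ []

template₂ : Template 2 0 5 9 10 12 8
template₂ = record
  { centre = partition-by-computation _≟Cell_ cellZeroSum?
      ((cell (₀ ∷ ₀ ∷ []) 1 𝟘 ∷ cell (₀ ∷ ₁ ∷ []) 1 𝟘 ∷ cell (₀ ∷ ₁ ∷ []) 2 𝟘 ∷ []) ∷
       (cell (₁ ∷ ₀ ∷ []) 1 𝟘 ∷ cell (₀ ∷ ₀ ∷ []) 3 𝟘 ∷ cell (₁ ∷ ₀ ∷ []) 0 𝟘 ∷ []) ∷
       (cell (₁ ∷ ₁ ∷ []) 1 𝟘 ∷ cell (₁ ∷ ₀ ∷ []) 3 𝟘 ∷ cell (₀ ∷ ₁ ∷ []) 0 𝟘 ∷ []) ∷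
       (cell (₀ ∷ ₁ ∷ []) 3 𝟘 ∷ cell (₁ ∷ ₁ ∷ []) 3 𝟘 ∷ cell (₁ ∷ ₀ ∷ []) 2 𝟘 ∷ []) ∷
       (cell (₁ ∷ ₁ ∷ []) 0 𝟘 ∷ cell (₁ ∷ ₁ ∷ []) 2 𝟘 ∷ cell (₀ ∷ ₀ ∷ []) 2 𝟘 ∷ []) ∷ [])
  ; triplesOrbit = partition-by-computation _≟Cell_ cellZeroSum? (shared ++ zeroColumn-triples)
  ; pairsOrbit   = partition-by-computation _≟Cell_ cellZeroSum? (shared ++ zeroColumn-pairs)
  }
  where
  shared : List (List (Cell 2))
  shared = negationPairs ((₀ ∷ ₁ ∷ []) ∷ (₁ ∷ ₀ ∷ []) ∷ (₁ ∷ ₁ ∷ []) ∷ []) units ++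
    (cell (₀ ∷ ₁ ∷ []) 0 𝟙 ∷ cell (₁ ∷ ₀ ∷ []) 2 ω ∷ cell (₁ ∷ ₁ ∷ []) 2 ω² ∷ []) ∷
    (cell (₁ ∷ ₀ ∷ []) 0 𝟙 ∷ cell (₀ ∷ ₁ ∷ []) 0 ω ∷ cell (₁ ∷ ₁ ∷ []) 0 ω² ∷ []) ∷
    (cell (₁ ∷ ₁ ∷ []) 0 𝟙 ∷ cell (₁ ∷ ₁ ∷ []) 2 ω ∷ cell (₀ ∷ ₀ ∷ []) 2 ω² ∷ []) ∷
    (cell (₀ ∷ ₀ ∷ []) 2 𝟙 ∷ cell (₁ ∷ ₀ ∷ []) 0 ω ∷ cell (₁ ∷ ₀ ∷ []) 2 ω² ∷ []) ∷
    (cell (₀ ∷ ₁ ∷ []) 2 𝟙 ∷ cell (₀ ∷ ₀ ∷ []) 2 ω ∷ cell (₀ ∷ ₁ ∷ []) 0 ω² ∷ []) ∷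
    (cell (₁ ∷ ₀ ∷ []) 2 𝟙 ∷ cell (₁ ∷ ₁ ∷ []) 0 ω ∷ cell (₀ ∷ ₁ ∷ []) 2 ω² ∷ []) ∷
    (cell (₁ ∷ ₁ ∷ []) 2 𝟙 ∷ cell (₀ ∷ ₁ ∷ []) 2 ω ∷ cell (₁ ∷ ₀ ∷ []) 0 ω² ∷ []) ∷ []

3∣2n⇒3∣n : ∀ {n} → 3 ∣ 2 * n → 3 ∣ n
3∣2n⇒3∣n {n} 3∣2n = ∣m+n∣m⇒∣n (subst (3 ∣_) (four n) (∣n⇒∣m*n 2 3∣2n)) (m∣m*n n)
  where
  four : ∀ n → 2 * (2 * n) ≡ 3 * n + n
  four = solve-∀

∸-by : ∀ {a b c} → a ≡ b + c → a ∸ b ≡ c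
∸-by {b = b} {c} refl = ℕ.m+n∸m≡n b c

/3-by : ∀ {a c} → a ≡ c * 3 → a / 3 ≡ c
/3-by {c = c} refl = m*n/n≡m c 3

by-difference : (P : ℕ → ℕ → Set) {s ρ : ℕ} → s ≤ ρ → (∀ d → P (s + d) d) → P ρ (ρ ∸ s)
by-difference P {s} {ρ} s≤ρ p = subst (λ r → P r (ρ ∸ s)) (ℕ.m+[n∸m]≡n s≤ρ) (p (ρ ∸ s))

≤-cancel : ∀ c {s ρ r} → r < c → c * s ≤ c * ρ + r → s ≤ ρ
≤-cancel c {s} {ρ} {r} r<c cs≤cρ+r = ℕ.≤-pred (ℕ.*-cancelˡ-< c s (suc ρ) (begin-strict
  c * s      ≤⟨ cs≤cρ+r ⟩
  c * ρ + r  <⟨ ℕ.+-monoʳ-< (c * ρ) r<c ⟩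
  c * ρ + c  ≡⟨ ℕ.+-comm (c * ρ) c ⟩
  c + c * ρ  ≡⟨ ℕ.*-suc c ρ ⟨
  c * suc ρ  ∎))
  where open ℕ.≤-Reasoning

-- m = 1 + 2k, where f = 2(1 + 3ρ) and |I| = 3 + 12ρ, so that t = 3s.

L≡₁ : ∀ ρ {L} → suc L ≡ 2 * suc (ρ * 3) * 2 → L ≡ 3 + ρ * 12
L≡₁ ρ sucL = ℕ.suc-injective (≡.trans sucL (form ρ))
  where
  form : ∀ ρ → 2 * suc (ρ * 3) * 2 ≡ suc (3 + ρ * 12)
  form = solve-∀

3∣t₁ : ∀ ρ t → 3 ∣ (3 + ρ * 12) + 2 * t → 3 ∣ t
3∣t₁ ρ t 3∣L+2t = 3∣2n⇒3∣n (∣m+n∣m⇒∣n 3∣L+2t (divides (1 + ρ * 4) (multiple ρ)))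
  where
  multiple : ∀ ρ → 3 + ρ * 12 ≡ (1 + ρ * 4) * 3
  multiple = solve-∀

s≤ρ₁ : ∀ ρ s → 4 * (s * 3) ≤ 2 * suc (ρ * 3) → s ≤ ρ
s≤ρ₁ ρ s bound = ≤-cancel 6 (s≤s (s≤s (s≤s z≤n))) (begin
  6 * s              ≤⟨ ℕ.m≤m+n (6 * s) (6 * s) ⟩
  6 * s + 6 * s      ≡⟨ scaled s ⟩
  4 * (s * 3)        ≤⟨ bound ⟩
  2 * suc (ρ * 3)    ≡⟨ f-form ρ ⟩
  6 * ρ + 2          ∎)
  where
  open ℕ.≤-Reasoning
  scaled : ∀ s → 6 * s + 6 * s ≡ 4 * (s * 3)
  scaled = solve-∀
  f-form : ∀ ρ → 2 * suc (ρ * 3) ≡ 6 * ρ + 2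
  f-form = solve-∀

pairs₁ : ∀ ρ s → s ≤ ρ → 2 * suc (ρ * 3) ∸ s * 3 ≡ 2 + (s * 3 + (ρ ∸ s) * 6)
pairs₁ ρ s s≤ρ = ∸-by (by-difference (λ r d → 2 * suc (r * 3) ≡ s * 3 + (2 + (s * 3 + d * 6))) s≤ρ (form s))
  where
  form : ∀ s d → 2 * suc ((s + d) * 3) ≡ s * 3 + (2 + (s * 3 + d * 6))
  form = solve-∀

triples₁ : ∀ ρ s → s ≤ ρ → (3 + ρ * 12 + 2 * (s * 3)) / 3 ≡ 1 + (s * 6 + (ρ ∸ s) * 4)
triples₁ ρ s s≤ρ = /3-by (by-difference (λ r d → 3 + r * 12 + 2 * (s * 3) ≡ (1 + (s * 6 + d * 4)) * 3) s≤ρ (form s))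
  where
  form : ∀ s d → 3 + (s + d) * 12 + 2 * (s * 3) ≡ (1 + (s * 6 + d * 4)) * 3
  form = solve-∀

mix₁ : ∀ ρ t {F L} → F ≡ 2 * suc (ρ * 3) → suc L ≡ 2 * suc (ρ * 3) * 2 → 4 * t ≤ F → 3 ∣ L + 2 * t →
       Mix ρ (F ∸ t) ((L + 2 * t) / 3) 2 1 3 6 6 4
mix₁ ρ t {F} {L} F≡ sucL bound 3∣L+2t = record
  { s       = s
  ; s≤ρ     = s≤ρ
  ; pairs   = ≡.trans (cong₂ _∸_ F≡ t≡) (pairs₁ ρ s s≤ρ)
  ; triples = ≡.trans (cong₂ (λ L t → (L + 2 * t) / 3) L≡ t≡) (triples₁ ρ s s≤ρ)
  }
  where
  L≡ = L≡₁ ρ sucL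
  3∣t = 3∣t₁ ρ t (subst (λ L → 3 ∣ L + 2 * t) L≡ 3∣L+2t)
  s = _∣_.quotient 3∣t
  t≡ = _∣_.equality 3∣t
  s≤ρ = s≤ρ₁ ρ s (subst₂ _≤_ (cong (4 *_) t≡) F≡ bound)

-- m = 2 + 2k, where f = 4(1 + 3ρ) and |I| = 7 + 24ρ, so that t = 4 + 3s.

L≡₂ : ∀ ρ {L} → suc L ≡ 4 * suc (ρ * 3) * 2 → L ≡ 7 + ρ * 24
L≡₂ ρ sucL = ℕ.suc-injective (≡.trans sucL (form ρ))
  where
  form : ∀ ρ → 4 * suc (ρ * 3) * 2 ≡ suc (7 + ρ * 24)
  form = solve-∀

3∣2+u₂ : ∀ ρ u → 3 ∣ (7 + ρ * 24) + 2 * (3 + u) → 3 ∣ 2 + u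
3∣2+u₂ ρ u 3∣L+2t = 3∣2n⇒3∣n (∣m+n∣m⇒∣n (subst (3 ∣_) (regroup ρ u) 3∣L+2t) (divides (3 + ρ * 8) refl))
  where
  regroup : ∀ ρ u → 7 + ρ * 24 + 2 * (3 + u) ≡ (3 + ρ * 8) * 3 + 2 * (2 + u)
  regroup = solve-∀

u≡₂ : ∀ u → 3 ∣ 2 + u → Σ[ s ∈ ℕ ] u ≡ 1 + s * 3
u≡₂ u (divides (suc s) 2+u≡) = s , ℕ.suc-injective (ℕ.suc-injective 2+u≡)

s≤ρ₂ : ∀ ρ s → 4 * (4 + s * 3) ≤ 4 * suc (ρ * 3) → s ≤ ρ
s≤ρ₂ ρ s bound = ≤-cancel 12 (s≤s (s≤s (s≤s (s≤s (s≤s z≤n))))) (begin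
  12 * s            ≤⟨ ℕ.m≤n+m (12 * s) 16 ⟩
  16 + 12 * s       ≡⟨ scaled s ⟩
  4 * (4 + s * 3)   ≤⟨ bound ⟩
  4 * suc (ρ * 3)   ≡⟨ f-form ρ ⟩
  12 * ρ + 4        ∎)
  where
  open ℕ.≤-Reasoning
  scaled : ∀ s → 16 + 12 * s ≡ 4 * (4 + s * 3)
  scaled = solve-∀
  f-form : ∀ ρ → 4 * suc (ρ * 3) ≡ 12 * ρ + 4
  f-form = solve-∀

pairs₂ : ∀ ρ s → s ≤ ρ → 4 * suc (ρ * 3) ∸ (4 + s * 3) ≡ 0 + (s * 9 + (ρ ∸ s) * 12)
pairs₂ ρ s s≤ρ = ∸-by (by-difference (λ r d → 4 * suc (r * 3) ≡ (4 + s * 3) + (0 + (s * 9 + d * 12))) s≤ρ (form s))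
  where
  form : ∀ s d → 4 * suc ((s + d) * 3) ≡ (4 + s * 3) + (0 + (s * 9 + d * 12))
  form = solve-∀

triples₂ : ∀ ρ s → s ≤ ρ → (7 + ρ * 24 + 2 * (4 + s * 3)) / 3 ≡ 5 + (s * 10 + (ρ ∸ s) * 8)
triples₂ ρ s s≤ρ = /3-by (by-difference (λ r d → 7 + r * 24 + 2 * (4 + s * 3) ≡ (5 + (s * 10 + d * 8)) * 3) s≤ρ (form s))
  where
  form : ∀ s d → 7 + (s + d) * 24 + 2 * (4 + s * 3) ≡ (5 + (s * 10 + d * 8)) * 3
  form = solve-∀

mix₂ : ∀ ρ t {F L} → F ≡ 4 * suc (ρ * 3) → suc L ≡ 4 * suc (ρ * 3) * 2 → 3 ≤ t → 4 * t ≤ F → 3 ∣ L + 2 * t →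
       Mix ρ (F ∸ t) ((L + 2 * t) / 3) 0 5 9 10 12 8
mix₂ ρ t {F} {L} F≡ sucL 3≤t bound 3∣L+2t = record
  { s       = s
  ; s≤ρ     = s≤ρ
  ; pairs   = ≡.trans (cong₂ _∸_ F≡ t≡) (pairs₂ ρ s s≤ρ)
  ; triples = ≡.trans (cong₂ (λ L t → (L + 2 * t) / 3) L≡ t≡) (triples₂ ρ s s≤ρ)
  }
  where
  L≡ = L≡₂ ρ sucL
  u = t ∸ 3
  t≡3+u : t ≡ 3 + u
  t≡3+u = sym (ℕ.m+[n∸m]≡n 3≤t)
  u-form = u≡₂ u (3∣2+u₂ ρ u (subst₂ (λ L t → 3 ∣ L + 2 * t) L≡ t≡3+u 3∣L+2t))
  s = proj₁ u-form
  t≡ : t ≡ 4 + s * 3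
  t≡ = ≡.trans t≡3+u (cong (3 +_) (proj₂ u-form))
  s≤ρ = s≤ρ₂ ρ s (subst₂ _≤_ (cong (4 *_) t≡) F≡ bound)

odd-or-even : ∀ m → m ≥ 1 → ∃[ k ] (m ≡ 1 + twice k ⊎ m ≡ 2 + twice k)
odd-or-even 1                   _ = 0 , inj₁ refl
odd-or-even 2                   _ = 0 , inj₂ refl
odd-or-even (suc (suc (suc m))) _ with odd-or-even (suc m) (s≤s z≤n)
... | k , inj₁ refl = suc k , inj₁ refl
... | k , inj₂ refl = suc k , inj₂ refl

2^on-orbits : ∀ a k → 2 ^ (a + twice k) ≡ 2 ^ a * suc (length (representatives k) * 3)
2^on-orbits a k = ≡.trans (ℕ.^-distribˡ-+-* 2 a (twice k)) (cong (2 ^ a *_) (sym (length-representatives k)))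

f-on-orbits : ∀ a k → f (a + twice k) ≡ 2 ^ a * suc (length (representatives k) * 3)
f-on-orbits a k = ≡.trans (f≡2^ (a + twice k)) (2^on-orbits a k)

I-on-orbits : ∀ a k → suc (length (I (a + twice k))) ≡ 2 ^ a * suc (length (representatives k) * 3) * 2
I-on-orbits a k = ≡.trans (suc-length-I (a + twice k)) (cong (_* 2) (2^on-orbits a k))

lemma6p33 : ∃[ m₀ ] ∀ (m : ℕ) → m ≥ m₀ → ∀ (t : ℕ) → 3 ≤ t → 1000 * t ≤ f m
  → 3 ∣ (length (I m) + 2 * t)
  → ZeroSumPartition m (replicate (f m ∸ t) 2 ++ replicate ((length (I m) + 2 * t) / 3) 3)
lemma6p33 = 1 , partition
  where
  4t≤1000t : ∀ t → 4 * t ≤ 1000 * t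
  4t≤1000t t = ℕ.*-monoˡ-≤ t (ℕ.m≤m+n 4 996)
  partition : ∀ m → m ≥ 1 → ∀ t → 3 ≤ t → 1000 * t ≤ f m → 3 ∣ length (I m) + 2 * t →
              ZeroSumPartition m (twosThrees (f m ∸ t) ((length (I m) + 2 * t) / 3))
  partition m m≥1 t 3≤t 1000t≤f 3∣L+2t with odd-or-even m m≥1
  ... | k , inj₁ refl = Template.zeroSumPartition template₁ k
                          (mix₁ _ t (f-on-orbits 1 k) (I-on-orbits 1 k) (ℕ.≤-trans (4t≤1000t t) 1000t≤f) 3∣L+2t)
  ... | k , inj₂ refl = Template.zeroSumPartition template₂ k
                          (mix₂ _ t (f-on-orbits 2 k) (I-on-orbits 2 k) 3≤t (ℕ.≤-trans (4t≤1000t t) 1000t≤f) 3∣L+2t)
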